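{- Let $G$ be a connected simple graph on $[N]$ and let $e=uv$ be an edge with $\deg_G(u)=2$. If $c\in\mathfrak{D}(G)$, then $\beta^{\triangle}(c):=(c,1)+e_u-e_{N+1}$ (equivalently $(c,0)+e_u$) belongs to $\mathfrak{D}(G\triangle e)$. Moreover, $\beta^{\triangle}:\mathfrak{D}(G)\to\mathfrak{D}(G\triangle e)$ is injective.
   Context: Let $\mathcal{N}_G(i)$ denote the set of neighbors of $i$ in a graph $G$ on $[N]$. A sequence $(a_1,\dots,a_N)\in\mathbb{Z}_{\ge0}^N$ is $D(G)$-draconian if $\sum_i a_i=N-1$ and for every nonempty $S\subseteq[N]$, $\sum_{i\in S}a_i<\left|S\cup\bigcup_{i\in S}\mathcal{N}_G(i)\right|$; $\mathfrak{D}(G)$ is the set of such sequences. $G\triangle e$ is the graph on $[N+1]$ with edge set $E(G)\cup\{u(N+1),v(N+1)\}$. $e_1,\dots,e_{N+1}$ are the standard basis vectors of $\mathbb{R}^{N+1}$. -}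

module Defs where

open import Data.Nat using (ℕ; zero; suc; _+_; _<_)
open import Data.Bool using (Bool; true; false; if_then_else_; _∨_; _∧_; T)
open import Data.Fin using (Fin; zero; suc; _≟_)
open import Data.Fin.Subset using (Subset; Nonempty; ∣_∣)
open import Data.Vec.Functional using (Vector)
open import Data.Vec using (tabulate; lookup)
import Data.Vec
import Data.Maybe
open import Data.Maybe using (Maybe; just; nothing)
open import Data.Product using (∃; _×_; _,_)
open import Relation.Binary.PropositionalEquality using (_≡_; refl)
open import Relation.Nullary using (¬_)
open import Relation.Nullary.Decidable using (⌊_⌋)

sumFin : ∀ {n} → (Fin n → ℕ) → ℕ
sumFin {zero}  f = 0
sumFin {suc n} f = f zero + sumFin (λ i → f (suc i))

countFin : ∀ {n} → (Fin n → Bool) → ℕ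
countFin p = sumFin (λ i → if p i then 1 else 0)

anyFin : ∀ {n} → (Fin n → Bool) → Bool
anyFin {zero}  p = false
anyFin {suc n} p = p zero ∨ anyFin (λ i → p (suc i))

record Graph (N : ℕ) : Set where
  field
    adj     : Fin N → Fin N → Bool
    symm    : ∀ i j → adj i j ≡ adj j i
    irrefl  : ∀ i → adj i i ≡ false
open Graph public

degree : ∀ {N} → Graph N → Fin N → ℕ
degree G u = countFin (adj G u)

data Reachable {N} (G : Graph N) : Fin N → Fin N → Set where
  here : ∀ {i} → Reachable G i i
  step : ∀ {i j k} → T (adj G i j) → Reachable G j k → Reachable G i k

Connected : ∀ {N} → Graph N → Set
Connected G = ∀ i j → Reachable G i j

memb : ∀ {N} → Fin N → Subset N → Bool
memb i S = Data.Vec.lookup S i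

closedNbhd : ∀ {N} → Graph N → Subset N → Subset N
closedNbhd G S = tabulate λ j →
  memb j S ∨ anyFin (λ i → memb i S ∧ adj G i j)

sumOver : ∀ {N} → Subset N → (Fin N → ℕ) → ℕ
sumOver S a = sumFin (λ i → if memb i S then a i else 0)

-- D(G)-draconian sequences: sum = N - 1 (written sum + 1 = N), and
-- for every nonempty S, sum_{i∈S} a_i < |S ∪ N_G(S)|.
Draconian : ∀ {N} → Graph N → (Fin N → ℕ) → Set
Draconian {N} G a =
  (sumFin a + 1 ≡ N) ×
  (∀ (S : Subset N) → Nonempty S → sumOver S a < ∣ closedNbhd G S ∣)

-- View of Fin (suc N): old vertex (just i) or the new vertex N+1 (nothing).
split : ∀ {N} → Fin (suc N) → Maybe (Fin N)
split {zero}  zero    = nothing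
split {suc N} zero    = just zero
split {suc N} (suc k) = Data.Maybe.map suc (split k)

eqb : ∀ {N} → Fin N → Fin N → Bool
eqb i j = ⌊ i ≟ j ⌋

-- G △ e for e = uv: add vertex N+1 (= Data.Fin.fromℕ N) adjacent to u and v.
triAdj : ∀ {N} → Graph N → Fin N → Fin N → Fin (suc N) → Fin (suc N) → Bool
triAdj G u v k l with split k | split l
... | just i  | just j  = adj G i j
... | just i  | nothing = eqb i u ∨ eqb i v
... | nothing | just j  = eqb j u ∨ eqb j v
... | nothing | nothing = false

betaTri : ∀ {N} → Fin N → (Fin N → ℕ) → Fin (suc N) → ℕ
betaTri u c k with split k
... | just i  = c i + (if eqb i u then 1 else 0)
... | nothing = 0

triAdj-symm : ∀ {N} (G : Graph N) u v k l → triAdj G u v k l ≡ triAdj G u v l k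
triAdj-symm G u v k l with split k | split l
... | just i  | just j  = symm G i j
... | just i  | nothing = refl
... | nothing | just j  = refl
... | nothing | nothing = refl

triAdj-irrefl : ∀ {N} (G : Graph N) u v k → triAdj G u v k k ≡ false
triAdj-irrefl G u v k with split k
... | just i  = irrefl G i
... | nothing = refl

_△_ : ∀ {N} → Graph N → Fin N × Fin N → Graph (suc N)
G △ (u , v) = record
  { adj = triAdj G u v ; symm = triAdj-symm G u v ; irrefl = triAdj-irrefl G u v }

-- Split a set S of vertices of G △ e into its old part T = S ∩ [N] and
-- possibly the new vertex N+1, on which β vanishes. Then the β-weight of S
-- is the c-weight of T plus one exactly when u ∈ T. The closed neighbourhood
-- of S in G △ e contains that of T in G, and also contains N+1 as soon as
-- u ∈ T, because u is adjacent to N+1; so the draconian inequality for T in G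
-- lifts to S. If T is empty the weight of S is 0, while its neighbourhood
-- contains S ≠ ∅. Injectivity holds since β only adds e_u on old vertices.
module Submission where

open import Defs
open import Data.Nat using (ℕ; zero; suc; _+_; _≤_; _<_; z≤n; s≤s)
open import Data.Nat.Properties
  using (+-identityʳ; +-comm; +-assoc; +-mono-≤; +-mono-<-≤; +-cancelʳ-≡;
         +-monoˡ-≤; ≤-refl; ≤-reflexive; ≤-trans; module ≤-Reasoning)
open import Data.Nat.Tactic.RingSolver using (solve-∀)
open import Data.Bool using (Bool; true; false; T; if_then_else_; _∨_; _∧_)
open import Data.Bool.Properties using (T-∨; T-∧; T-≡)
open import Data.Fin using (Fin; zero; suc; inject₁; fromℕ; _≟_)
open import Data.Fin.Subset using (Subset; Nonempty; Empty; ∣_∣; inside; outside)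
open import Data.Fin.Subset.Properties using (nonempty?)
open import Data.Vec using (_∷_; tabulate)
open import Data.Vec.Properties using (lookup∘tabulate; lookup⇒[]=; []=⇒lookup)
open import Data.Maybe using (just; nothing)
import Data.Maybe
open import Data.Product using (_×_; _,_; ∃)
open import Data.Sum using (_⊎_; inj₁; inj₂)
open import Data.Empty using (⊥-elim)
open import Function using (_∘_; Equivalence)
open import Relation.Binary.PropositionalEquality
  using (_≡_; refl; sym; trans; cong; cong₂; subst; module ≡-Reasoning)
open import Relation.Nullary using (yes; no)

open Equivalence using (to; from)

sumFin-cong : ∀ {n} {f g : Fin n → ℕ} → (∀ i → f i ≡ g i) → sumFin f ≡ sumFin g
sumFin-cong {zero}  f≗g = refl
sumFin-cong {suc n} f≗g = cong₂ _+_ (f≗g zero) (sumFin-cong (f≗g ∘ suc))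

sumFin-mono : ∀ {n} {f g : Fin n → ℕ} → (∀ i → f i ≤ g i) → sumFin f ≤ sumFin g
sumFin-mono {zero}  f≤g = z≤n
sumFin-mono {suc n} f≤g = +-mono-≤ (f≤g zero) (sumFin-mono (f≤g ∘ suc))

sumFin-+ : ∀ {n} (f g : Fin n → ℕ) → sumFin (λ i → f i + g i) ≡ sumFin f + sumFin g
sumFin-+ {zero}  f g = refl
sumFin-+ {suc n} f g = trans (cong (f zero + g zero +_) (sumFin-+ (f ∘ suc) (g ∘ suc)))
                             (interchange (f zero) (g zero) _ _)
  where
  interchange : ∀ a b c d → a + b + (c + d) ≡ a + c + (b + d)
  interchange = solve-∀

sumFin-zero : ∀ n → sumFin {n} (λ _ → 0) ≡ 0
sumFin-zero zero    = refl
sumFin-zero (suc n) = sumFin-zero n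

sumFin-init-last : ∀ {n} (f : Fin (suc n) → ℕ) →
  sumFin f ≡ sumFin (f ∘ inject₁) + f (fromℕ n)
sumFin-init-last {zero}  f = +-comm (f zero) 0
sumFin-init-last {suc n} f = trans (cong (f zero +_) (sumFin-init-last (f ∘ suc)))
                                   (sym (+-assoc (f zero) _ _))

-- Needed because ⌊_⌋ does not compute through the map′ in suc i ≟ suc u.
eqb-suc : ∀ {n} (i u : Fin n) → eqb (suc i) (suc u) ≡ eqb i u
eqb-suc i u with i ≟ u
... | yes _ = refl
... | no _  = refl

eqb-refl : ∀ {n} (u : Fin n) → T (eqb u u)
eqb-refl u with u ≟ u
... | yes _  = _
... | no u≢u = u≢u refl

sumFin-point : ∀ {n} (u : Fin n) (x : ℕ) → sumFin (λ i → if eqb i u then x else 0) ≡ x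
sumFin-point {suc n} zero    x = trans (cong (x +_) (sumFin-zero n)) (+-identityʳ x)
sumFin-point {suc n} (suc u) x =
  trans (sumFin-cong (λ i → cong (λ b → if b then x else 0) (eqb-suc i u))) (sumFin-point u x)

sumOver-cong : ∀ {n} (S : Subset n) {a b : Fin n → ℕ} → (∀ i → a i ≡ b i) → sumOver S a ≡ sumOver S b
sumOver-cong S a≗b = sumFin-cong (λ i → cong (λ x → if memb i S then x else 0) (a≗b i))

sumOver-+ : ∀ {n} (S : Subset n) (a b : Fin n → ℕ) →
  sumOver S (λ i → a i + b i) ≡ sumOver S a + sumOver S b
sumOver-+ S a b =
  trans (sumFin-cong split-if)
        (sumFin-+ (λ i → if memb i S then a i else 0) (λ i → if memb i S then b i else 0))
  where
  split-if : ∀ i → (if memb i S then a i + b i else 0)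
                 ≡ (if memb i S then a i else 0) + (if memb i S then b i else 0)
  split-if i with memb i S
  ... | true  = refl
  ... | false = refl

sumOver-point : ∀ {n} (S : Subset n) (u : Fin n) (x : ℕ) →
  sumOver S (λ i → if eqb i u then x else 0) ≡ (if memb u S then x else 0)
sumOver-point S u x = trans (sumFin-cong move-test) (sumFin-point u _)
  where
  move-test : ∀ i → (if memb i S then (if eqb i u then x else 0) else 0)
                  ≡ (if eqb i u then (if memb u S then x else 0) else 0)
  move-test i with i ≟ u
  ... | yes refl = refl
  ... | no _ with memb i S
  ...   | true  = refl
  ...   | false = refl

sumOver-Empty : ∀ {n} (S : Subset n) (a : Fin n → ℕ) → Empty S → sumOver S a ≡ 0
sumOver-Empty {n} S a S-empty = trans (sumFin-cong vanish) (sumFin-zero n)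
  where
  vanish : ∀ i → (if memb i S then a i else 0) ≡ 0
  vanish i with memb i S in i∈S
  ... | true  = ⊥-elim (S-empty (i , lookup⇒[]= i S i∈S))
  ... | false = refl

indicator-mono : ∀ {b b′ : Bool} → (T b → T b′) → (if b then 1 else 0) ≤ (if b′ then 1 else 0)
indicator-mono {false}           _   = z≤n
indicator-mono {true}  {true}    _   = ≤-refl
indicator-mono {true}  {false} b⇒b′ = ⊥-elim (b⇒b′ _)

countFin-mono : ∀ {n} {p q : Fin n → Bool} → (∀ i → T (p i) → T (q i)) → countFin p ≤ countFin q
countFin-mono p⇒q = sumFin-mono (indicator-mono ∘ p⇒q)

countFin-pos : ∀ {n} (p : Fin n → Bool) (i : Fin n) → T (p i) → 0 < countFin p
countFin-pos p zero    pi with p zero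
... | true = s≤s z≤n
countFin-pos p (suc i) pi with p zero
... | true  = s≤s z≤n
... | false = countFin-pos (p ∘ suc) i pi

∣S∣≡countFin-memb : ∀ {n} (S : Subset n) → ∣ S ∣ ≡ countFin (λ i → memb i S)
∣S∣≡countFin-memb Data.Vec.[]    = refl
∣S∣≡countFin-memb (outside ∷ S) = ∣S∣≡countFin-memb S
∣S∣≡countFin-memb (inside ∷ S)  = cong suc (∣S∣≡countFin-memb S)

anyFin-intro : ∀ {n} (p : Fin n → Bool) (i : Fin n) → T (p i) → T (anyFin p)
anyFin-intro p zero    pi = from T-∨ (inj₁ pi)
anyFin-intro p (suc i) pi = from T-∨ (inj₂ (anyFin-intro (p ∘ suc) i pi))

anyFin-elim : ∀ {n} (p : Fin n → Bool) → T (anyFin p) → ∃ λ i → T (p i)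
anyFin-elim {suc n} p any-p with to T-∨ any-p
... | inj₁ p0   = zero , p0
... | inj₂ rest with anyFin-elim (p ∘ suc) rest
...   | i , pi = suc i , pi

∣S∣-init-last : ∀ {n} (S : Subset (suc n)) →
  ∣ S ∣ ≡ countFin (λ i → memb (inject₁ i) S) + (if memb (fromℕ n) S then 1 else 0)
∣S∣-init-last S = trans (∣S∣≡countFin-memb S) (sumFin-init-last (λ k → if memb k S then 1 else 0))

memb-closedNbhd : ∀ {n} (G : Graph n) (S : Subset n) (k : Fin n) →
  memb k (closedNbhd G S) ≡ (memb k S ∨ anyFin (λ i → memb i S ∧ adj G i k))
memb-closedNbhd G S k = lookup∘tabulate _ k

∈closedNbhd-self : ∀ {n} (G : Graph n) (S : Subset n) (k : Fin n) →
  T (memb k S) → T (memb k (closedNbhd G S))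
∈closedNbhd-self G S k k∈S =
  subst T (sym (memb-closedNbhd G S k)) (from (T-∨ {memb k S}) (inj₁ k∈S))

∈closedNbhd-nbr : ∀ {n} (G : Graph n) (S : Subset n) (i k : Fin n) →
  T (memb i S) → T (adj G i k) → T (memb k (closedNbhd G S))
∈closedNbhd-nbr G S i k i∈S ik =
  subst T (sym (memb-closedNbhd G S k))
    (from (T-∨ {memb k S}) (inj₂ (anyFin-intro (λ l → memb l S ∧ adj G l k) i
      (from (T-∧ {memb i S}) (i∈S , ik)))))

∈closedNbhd-elim : ∀ {n} (G : Graph n) (S : Subset n) (k : Fin n) → T (memb k (closedNbhd G S)) →
  T (memb k S) ⊎ ∃ λ i → T (memb i S) × T (adj G i k)
∈closedNbhd-elim G S k k∈NS with to (T-∨ {memb k S}) (subst T (memb-closedNbhd G S k) k∈NS)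
... | inj₁ k∈S    = inj₁ k∈S
... | inj₂ any-nbr with anyFin-elim _ any-nbr
...   | i , i∈S∧ik = inj₂ (i , to (T-∧ {memb i S}) i∈S∧ik)

restrict : ∀ {n} → Subset (suc n) → Subset n
restrict S = tabulate (λ i → memb (inject₁ i) S)

memb-restrict : ∀ {n} (S : Subset (suc n)) (i : Fin n) → memb i (restrict S) ≡ memb (inject₁ i) S
memb-restrict S i = lookup∘tabulate _ i

sumOver-restrict : ∀ {n} (S : Subset (suc n)) (a : Fin (suc n) → ℕ) → a (fromℕ n) ≡ 0 →
  sumOver S a ≡ sumOver (restrict S) (a ∘ inject₁)
sumOver-restrict {n} S a a-last≡0 = begin
  sumOver S a
    ≡⟨ sumFin-init-last (λ k → if memb k S then a k else 0) ⟩
  sumFin (λ i → if memb (inject₁ i) S then a (inject₁ i) else 0) + (if memb (fromℕ n) S then a (fromℕ n) else 0)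
    ≡⟨ cong₂ _+_ (sumFin-cong (λ i → cong (λ b → if b then a (inject₁ i) else 0) (sym (memb-restrict S i))))
                 (vanish (memb (fromℕ n) S)) ⟩
  sumOver (restrict S) (a ∘ inject₁) + 0
    ≡⟨ +-identityʳ _ ⟩
  sumOver (restrict S) (a ∘ inject₁) ∎
  where
  open ≡-Reasoning
  vanish : ∀ b → (if b then a (fromℕ n) else 0) ≡ 0
  vanish true  = a-last≡0
  vanish false = refl

split-inject₁ : ∀ {n} (i : Fin n) → split (inject₁ i) ≡ just i
split-inject₁ {suc n} zero    = refl
split-inject₁ {suc n} (suc i) = cong (Data.Maybe.map suc) (split-inject₁ i)

split-fromℕ : ∀ n → split (fromℕ n) ≡ nothing
split-fromℕ zero    = refl
split-fromℕ (suc n) = cong (Data.Maybe.map suc) (split-fromℕ n)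

betaTri-inject₁ : ∀ {N} (u : Fin N) (c : Fin N → ℕ) (i : Fin N) →
  betaTri u c (inject₁ i) ≡ c i + (if eqb i u then 1 else 0)
betaTri-inject₁ u c i rewrite split-inject₁ i = refl

betaTri-new : ∀ {N} (u : Fin N) (c : Fin N → ℕ) → betaTri u c (fromℕ N) ≡ 0
betaTri-new {N} u c rewrite split-fromℕ N = refl

sumFin-betaTri : ∀ {N} (u : Fin N) (c : Fin N → ℕ) → sumFin (betaTri u c) ≡ sumFin c + 1
sumFin-betaTri {N} u c = begin
  sumFin (betaTri u c)
    ≡⟨ sumFin-init-last (betaTri u c) ⟩
  sumFin (betaTri u c ∘ inject₁) + betaTri u c (fromℕ N)
    ≡⟨ cong₂ _+_ (sumFin-cong (betaTri-inject₁ u c)) (betaTri-new u c) ⟩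
  sumFin (λ i → c i + (if eqb i u then 1 else 0)) + 0
    ≡⟨ +-identityʳ _ ⟩
  sumFin (λ i → c i + (if eqb i u then 1 else 0))
    ≡⟨ sumFin-+ c (λ i → if eqb i u then 1 else 0) ⟩
  sumFin c + sumFin (λ i → if eqb i u then 1 else 0)
    ≡⟨ cong (sumFin c +_) (sumFin-point u 1) ⟩
  sumFin c + 1 ∎
  where open ≡-Reasoning

sumOver-betaTri : ∀ {N} (u : Fin N) (c : Fin N → ℕ) (S : Subset (suc N)) →
  sumOver S (betaTri u c) ≡ sumOver (restrict S) c + (if memb u (restrict S) then 1 else 0)
sumOver-betaTri u c S = begin
  sumOver S (betaTri u c)
    ≡⟨ sumOver-restrict S (betaTri u c) (betaTri-new u c) ⟩
  sumOver R (betaTri u c ∘ inject₁)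
    ≡⟨ sumOver-cong R (betaTri-inject₁ u c) ⟩
  sumOver R (λ i → c i + (if eqb i u then 1 else 0))
    ≡⟨ sumOver-+ R c (λ i → if eqb i u then 1 else 0) ⟩
  sumOver R c + sumOver R (λ i → if eqb i u then 1 else 0)
    ≡⟨ cong (sumOver R c +_) (sumOver-point R u 1) ⟩
  sumOver R c + (if memb u R then 1 else 0) ∎
  where
  open ≡-Reasoning
  R = restrict S

module _ {N} (G : Graph N) (u v : Fin N) where

  adj-△-inject₁ : ∀ i j → adj (G △ (u , v)) (inject₁ i) (inject₁ j) ≡ adj G i j
  adj-△-inject₁ i j rewrite split-inject₁ i | split-inject₁ j = refl

  adj-△-new : T (adj (G △ (u , v)) (inject₁ u) (fromℕ N))
  adj-△-new rewrite split-inject₁ u | split-fromℕ N = from T-∨ (inj₁ (eqb-refl u))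

  closedNbhd-△-inject₁ : ∀ (S : Subset (suc N)) i →
    T (memb i (closedNbhd G (restrict S))) → T (memb (inject₁ i) (closedNbhd (G △ (u , v)) S))
  closedNbhd-△-inject₁ S i i∈NT with ∈closedNbhd-elim G (restrict S) i i∈NT
  ... | inj₁ i∈T = ∈closedNbhd-self (G △ (u , v)) S (inject₁ i) (subst T (memb-restrict S i) i∈T)
  ... | inj₂ (j , j∈T , ji) = ∈closedNbhd-nbr (G △ (u , v)) S (inject₁ j) (inject₁ i)
          (subst T (memb-restrict S j) j∈T) (subst T (sym (adj-△-inject₁ j i)) ji)

  closedNbhd-△-new : ∀ (S : Subset (suc N)) →
    T (memb u (restrict S)) → T (memb (fromℕ N) (closedNbhd (G △ (u , v)) S))
  closedNbhd-△-new S u∈T = ∈closedNbhd-nbr (G △ (u , v)) S (inject₁ u) (fromℕ N)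
    (subst T (memb-restrict S u) u∈T) adj-△-new

  ∣closedNbhd-restrict∣≤ : ∀ (S : Subset (suc N)) →
    ∣ closedNbhd G (restrict S) ∣ ≤ countFin (λ i → memb (inject₁ i) (closedNbhd (G △ (u , v)) S))
  ∣closedNbhd-restrict∣≤ S = ≤-trans (≤-reflexive (∣S∣≡countFin-memb (closedNbhd G (restrict S))))
                                   (countFin-mono (closedNbhd-△-inject₁ S))

  module _ (c : Fin N → ℕ) where

    betaTri-bound-nonempty : (∀ R → Nonempty R → sumOver R c < ∣ closedNbhd G R ∣) →
      ∀ S → Nonempty (restrict S) → sumOver S (betaTri u c) < ∣ closedNbhd (G △ (u , v)) S ∣
    betaTri-bound-nonempty c-bound S R≠∅ = begin-strict
      sumOver S (betaTri u c)
        ≡⟨ sumOver-betaTri u c S ⟩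
      sumOver R c + (if memb u R then 1 else 0)
        <⟨ +-mono-<-≤ (c-bound R R≠∅) (indicator-mono (closedNbhd-△-new S)) ⟩
      ∣ closedNbhd G R ∣ + (if memb (fromℕ N) NS then 1 else 0)
        ≤⟨ +-monoˡ-≤ _ (∣closedNbhd-restrict∣≤ S) ⟩
      countFin (λ i → memb (inject₁ i) NS) + (if memb (fromℕ N) NS then 1 else 0)
        ≡⟨ ∣S∣-init-last NS ⟨
      ∣ NS ∣ ∎
      where
      open ≤-Reasoning
      R = restrict S
      NS = closedNbhd (G △ (u , v)) S

    betaTri-bound-empty : ∀ S → Nonempty S → Empty (restrict S) →
      sumOver S (betaTri u c) < ∣ closedNbhd (G △ (u , v)) S ∣
    betaTri-bound-empty S (x , x∈S) R=∅ = begin-strict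
      sumOver S (betaTri u c)
        ≡⟨ sumOver-restrict S (betaTri u c) (betaTri-new u c) ⟩
      sumOver (restrict S) (betaTri u c ∘ inject₁)
        ≡⟨ sumOver-Empty (restrict S) _ R=∅ ⟩
      0
        <⟨ countFin-pos (λ k → memb k NS) x
             (∈closedNbhd-self (G △ (u , v)) S x (from T-≡ ([]=⇒lookup x∈S))) ⟩
      countFin (λ k → memb k NS)
        ≡⟨ ∣S∣≡countFin-memb NS ⟨
      ∣ NS ∣ ∎
      where
      open ≤-Reasoning
      NS = closedNbhd (G △ (u , v)) S

    betaTri-draconian : Draconian G c → Draconian (G △ (u , v)) (betaTri u c)
    betaTri-draconian (Σc+1≡N , c-bound) = Σβ+1≡N+1 , β-bound
      where
      Σβ+1≡N+1 : sumFin (betaTri u c) + 1 ≡ suc N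
      Σβ+1≡N+1 = trans (cong (_+ 1) (trans (sumFin-betaTri u c) Σc+1≡N)) (+-comm N 1)
      β-bound : ∀ S → Nonempty S → sumOver S (betaTri u c) < ∣ closedNbhd (G △ (u , v)) S ∣
      β-bound S S≠∅ with nonempty? (restrict S)
      ... | yes R≠∅ = betaTri-bound-nonempty c-bound S R≠∅
      ... | no  R=∅ = betaTri-bound-empty S S≠∅ R=∅

betaTri-injective : ∀ {N} (u : Fin N) (c c′ : Fin N → ℕ) →
  (∀ k → betaTri u c k ≡ betaTri u c′ k) → ∀ i → c i ≡ c′ i
betaTri-injective u c c′ β≗β′ i = +-cancelʳ-≡ _ (c i) (c′ i)
  (trans (sym (betaTri-inject₁ u c i)) (trans (β≗β′ (inject₁ i)) (betaTri-inject₁ u c′ i)))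

lemma3p15 : ∀ {N} (G : Graph N) (u v : Fin N) →
    Connected G → T (adj G u v) → degree G u ≡ 2 →
    (∀ (c : Fin N → ℕ) → Draconian G c → Draconian (G △ (u , v)) (betaTri u c))
    × (∀ (c c′ : Fin N → ℕ) → Draconian G c → Draconian G c′ →
        (∀ k → betaTri u c k ≡ betaTri u c′ k) → ∀ i → c i ≡ c′ i)
lemma3p15 G u v _ _ _ =
  betaTri-draconian G u v , λ c c′ _ _ → betaTri-injective u c c′
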